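{- Let $G$ be a $(P_2\cup P_4,\ \mathrm{HVN})$-free graph with $\omega=\omega(G)\ge 4$. Let $A$ be an induced complete $\omega$-partite subgraph of $G$ of maximum order (among all induced complete $\omega$-partite subgraphs of $G$), with parts $A_1,\dots,A_\omega$, and let $H=G-V(A)$. Then for every vertex $v\in V(H)$, the set $N_A(v)$ of neighbours of $v$ in $V(A)$ intersects at most one of the parts $A_1,\dots,A_\omega$.
   Context: All graphs are finite and simple. $P_2\cup P_4$ is the disjoint union of the paths on $2$ and $4$ vertices; the HVN is $K_5$ minus two edges incident to a common vertex; "$H$-free" means no induced subgraph isomorphic to $H$. A complete $\omega$-partite graph is one whose vertex set is partitioned into $\omega$ nonempty stable sets (parts) such that any two vertices in different parts are adjacent. $G-S$ denotes the graph obtained by deleting the vertex set $S$. -}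

module Defs where

open import Data.Nat using (ℕ; zero; suc; _+_; _≤_; _≡ᵇ_)
open import Data.Fin using (Fin; toℕ)
open import Data.Bool using (Bool; true; false; not; if_then_else_)
open import Data.Maybe using (Maybe; just; nothing; is-just)
open import Data.Product using (Σ; ∃; _×_; _,_)
open import Relation.Binary.PropositionalEquality using (_≡_; _≢_)
open import Relation.Nullary using (¬_)
open import Function.Definitions using (Injective)

record Graph : Set where
  field
    n      : ℕ
    adj    : Fin n → Fin n → Bool
    sym    : ∀ x y → adj x y ≡ adj y x
    irrefl : ∀ x → adj x x ≡ false
open Graph public

InducedCopy : (G : Graph) (k : ℕ) (adjH : Fin k → Fin k → Bool) → Set
InducedCopy G k adjH =
  Σ (Fin k → Fin (n G)) λ f →
    Injective _≡_ _≡_ f × (∀ i j → adj G (f i) (f j) ≡ adjH i j)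

Free : (G : Graph) (k : ℕ) (adjH : Fin k → Fin k → Bool) → Set
Free G k adjH = ¬ InducedCopy G k adjH

p2p4ℕ : ℕ → ℕ → Bool
p2p4ℕ 0 1 = true
p2p4ℕ 1 0 = true
p2p4ℕ 2 3 = true
p2p4ℕ 3 2 = true
p2p4ℕ 3 4 = true
p2p4ℕ 4 3 = true
p2p4ℕ 4 5 = true
p2p4ℕ 5 4 = true
p2p4ℕ _ _ = false

P2∪P4 : Fin 6 → Fin 6 → Bool
P2∪P4 i j = p2p4ℕ (toℕ i) (toℕ j)

hvnℕ : ℕ → ℕ → Bool
hvnℕ 0 1 = false
hvnℕ 1 0 = false
hvnℕ 0 2 = false
hvnℕ 2 0 = false
hvnℕ m n = not (m ≡ᵇ n)

HVN : Fin 5 → Fin 5 → Bool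
HVN i j = hvnℕ (toℕ i) (toℕ j)

IsClique : (G : Graph) (k : ℕ) → (Fin k → Fin (n G)) → Set
IsClique G k f = Injective _≡_ _≡_ f × (∀ i j → i ≢ j → adj G (f i) (f j) ≡ true)

HasClique : Graph → ℕ → Set
HasClique G k = Σ (Fin k → Fin (n G)) (IsClique G k)

IsCliqueNumber : Graph → ℕ → Set
IsCliqueNumber G ω = HasClique G ω × ¬ HasClique G (suc ω)

-- An induced complete ω-partite subgraph A of G, given by a part assignment:
-- part v ≡ nothing means v ∉ V(A); part v ≡ just i means v ∈ A_i.
IsCompleteMultipartite : (G : Graph) (ω : ℕ) → (Fin (n G) → Maybe (Fin ω)) → Set
IsCompleteMultipartite G ω part =
  (∀ i → ∃ λ v → part v ≡ just i) ×
  (∀ u v i → part u ≡ just i → part v ≡ just i → adj G u v ≡ false) ×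
  (∀ u v i j → part u ≡ just i → part v ≡ just j → i ≢ j → adj G u v ≡ true)

countTrue : (m : ℕ) → (Fin m → Bool) → ℕ
countTrue zero    p = 0
countTrue (suc m) p = (if p Fin.zero then 1 else 0) + countTrue m (λ x → p (Fin.suc x))

order : (G : Graph) (ω : ℕ) → (Fin (n G) → Maybe (Fin ω)) → ℕ
order G ω part = countTrue (n G) (λ v → is-just (part v))

IsMaxCompleteMultipartite : (G : Graph) (ω : ℕ) → (Fin (n G) → Maybe (Fin ω)) → Set
IsMaxCompleteMultipartite G ω part =
  IsCompleteMultipartite G ω part ×
  (∀ part' → IsCompleteMultipartite G ω part' → order G ω part' ≤ order G ω part)

{-# OPTIONS --safe #-}
-- Let v lie outside A. Some part A_k contains no neighbour of v, for otherwise v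
-- together with one neighbour in each part is a clique of size ω + 1. If v were
-- adjacent to every vertex of A outside A_k, moving v into A_k would give a larger
-- complete ω-partite subgraph; hence v has a non-neighbour in some part A_k′ with
-- k′ ≠ k. Now suppose v had neighbours in two parts A_i ≠ A_j. Since ω ≥ 4 there is
-- a fourth part A_m, and whether or not v sees a vertex of A_m, one obtains two
-- non-neighbours and two neighbours of v lying in four distinct parts. These four
-- vertices span a K₄, which together with v is an induced HVN.
module Submission where

open import Defs
open import Data.Nat using (ℕ; zero; suc; _≤_; _<_; z≤n; s≤s)
open import Data.Nat.Properties using (≤-refl; <⇒≱; +-mono-≤; +-mono-≤-<)
open import Data.Fin using (Fin; zero; suc; _≟_)
open import Data.Fin.Properties using (any?; all?; ¬∀⟶∃¬; injective⇒≤)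
open import Data.Maybe using (Maybe; just; nothing; is-just)
import Data.Maybe.Properties as Maybe
open import Data.Bool using (Bool; true; false; not; if_then_else_)
open import Data.Bool.Properties using (¬-not) renaming (_≟_ to _≟ᵇ_)
open import Data.Vec using (Vec; []; _∷_; lookup)
open import Data.Vec.Membership.Propositional using (_∈_; _∉_)
import Data.Vec.Membership.DecPropositional as DecMembership
open import Data.Vec.Relation.Unary.Any using (here; there)
open import Data.Vec.Relation.Unary.Any.Properties using (lookup-index)
open import Data.Vec.Relation.Unary.All using (_∷_; [])
open import Data.Vec.Relation.Unary.AllPairs using (_∷_; [])
open import Data.Vec.Relation.Unary.Unique.Propositional using (Unique)
open import Data.Vec.Relation.Unary.Unique.Propositional.Properties using (lookup-injective)
open import Data.Product using (∃; _×_; _,_; proj₁; proj₂)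
open import Data.Sum using (_⊎_; inj₁; inj₂)
open import Data.Empty using (⊥-elim)
open import Function using (id; _∘_; case_of_)
open import Function.Definitions using (Injective)
open import Relation.Nullary using (¬_; Dec; yes; no; ¬?; does)
open import Relation.Nullary.Decidable using (_×-dec_; toWitness; decidable-stable; dec-false)
open import Relation.Binary.PropositionalEquality using (_≡_; _≢_; refl; trans; cong; ≢-sym)
  renaming (sym to ≡-sym)

indicator-mono : ∀ {b c} → (b ≡ true → c ≡ true) → (if b then 1 else 0) ≤ (if c then 1 else 0)
indicator-mono {false}        _   = z≤n
indicator-mono {true} {true}  _   = ≤-refl
indicator-mono {true} {false} b⇒c with () ← b⇒c refl

countTrue-mono : ∀ m {p q : Fin m → Bool} → (∀ x → p x ≡ true → q x ≡ true) →
                 countTrue m p ≤ countTrue m q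
countTrue-mono zero    p⊆q = z≤n
countTrue-mono (suc m) p⊆q = +-mono-≤ (indicator-mono (p⊆q zero)) (countTrue-mono m (p⊆q ∘ suc))

countTrue-mono-< : ∀ m {p q : Fin m → Bool} → (∀ x → p x ≡ true → q x ≡ true) →
                   ∀ y → p y ≡ false → q y ≡ true → countTrue m p < countTrue m q
countTrue-mono-< (suc m) p⊆q zero py qy rewrite py | qy = s≤s (countTrue-mono m (p⊆q ∘ suc))
countTrue-mono-< (suc m) p⊆q (suc y) py qy =
  +-mono-≤-< (indicator-mono (p⊆q zero)) (countTrue-mono-< m (p⊆q ∘ suc) y py qy)

∃-∉ : ∀ {m n} (xs : Vec (Fin n) m) → m < n → ∃ λ y → y ∉ xs
∃-∉ {n = n} xs m<n = ¬∀⟶∃¬ n (_∈ xs) (λ y → DecMembership._∈?_ _≟_ y xs) λ all∈ →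
  <⇒≱ m<n (injective⇒≤ λ {y z} eq →
    trans (lookup-index (all∈ y)) (trans (cong (lookup xs) eq) (≡-sym (lookup-index (all∈ z)))))

cliqueWithApex : ∀ {m} → (Fin m → Bool) → Fin (suc m) → Fin (suc m) → Bool
cliqueWithApex r zero    zero    = false
cliqueWithApex r zero    (suc t) = r t
cliqueWithApex r (suc s) zero    = r s
cliqueWithApex r (suc s) (suc t) = not (does (s ≟ t))

HVN-apexRow : Fin 4 → Bool
HVN-apexRow = lookup (false ∷ false ∷ true ∷ true ∷ [])

HVN≗cliqueWithApex : ∀ x y → cliqueWithApex HVN-apexRow x y ≡ HVN x y
HVN≗cliqueWithApex =
  toWitness {a? = all? λ x → all? λ y → cliqueWithApex HVN-apexRow x y ≟ᵇ HVN x y} _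

cliqueWithApex-full : ∀ {m} {x y : Fin (suc m)} → x ≢ y → cliqueWithApex (λ _ → true) x y ≡ true
cliqueWithApex-full {x = zero}  {zero}  x≢y = ⊥-elim (x≢y refl)
cliqueWithApex-full {x = zero}  {suc t} x≢y = refl
cliqueWithApex-full {x = suc s} {zero}  x≢y = refl
cliqueWithApex-full {x = suc s} {suc t} x≢y = cong not (dec-false (s ≟ t) (x≢y ∘ cong suc))

InducedCopy-resp : ∀ G {k} {H H′ : Fin k → Fin k → Bool} → (∀ x y → H x y ≡ H′ x y) →
                   InducedCopy G k H → InducedCopy G k H′
InducedCopy-resp G H≗H′ (f , f-inj , f-adj) = f , f-inj , λ x y → trans (f-adj x y) (H≗H′ x y)

module _ (G : Graph) {ω : ℕ} {part : Fin (n G) → Maybe (Fin ω)}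
         (multipartite : IsCompleteMultipartite G ω part) where

  private
    V = Fin (n G)
    nonempty = proj₁ multipartite
    stable = proj₁ (proj₂ multipartite)
    complete = proj₂ (proj₂ multipartite)

  AdjIn : V → Bool → Fin ω → Set
  AdjIn v b k = ∃ λ w → part w ≡ just k × adj G v w ≡ b

  adjIn? : ∀ v b k → Dec (AdjIn v b k)
  adjIn? v b k = any? λ w → Maybe.≡-dec _≟_ (part w) (just k) ×-dec (adj G v w ≟ᵇ b)

  adjIn-some : ∀ v k → ∃ λ b → AdjIn v b k
  adjIn-some v k = let (w , pw) = nonempty k in adj G v w , w , pw , refl

  ¬adjIn-true : ∀ {v k} → ¬ AdjIn v true k → ∀ w → part w ≡ just k → adj G v w ≡ false
  ¬adjIn-true ¬vk w pw = ¬-not λ vw → ¬vk (w , pw , vw)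

  -- Witnesses from pairwise distinct parts are pairwise adjacent, so they span the K_m.
  apex-copy : ∀ {m v} {p : Fin m → Fin ω} → part v ≡ nothing → Injective _≡_ _≡_ p →
              (r : Fin m → Bool) → (∀ t → AdjIn v (r t) (p t)) →
              InducedCopy G (suc m) (cliqueWithApex r)
  apex-copy {v = v} {p} pv p-inj r wit = f , f-inj , f-adj
    where
    g : Fin _ → V
    g t = proj₁ (wit t)
    g-part : ∀ t → part (g t) ≡ just (p t)
    g-part t = proj₁ (proj₂ (wit t))
    f : Fin (suc _) → V
    f zero    = v
    f (suc t) = g t
    v≢g : ∀ t → v ≢ g t
    v≢g t eq with () ← trans (≡-sym pv) (trans (cong part eq) (g-part t))
    f-inj : Injective _≡_ _≡_ f
    f-inj {zero}  {zero}  _  = refl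
    f-inj {zero}  {suc t} eq = ⊥-elim (v≢g t eq)
    f-inj {suc s} {zero}  eq = ⊥-elim (v≢g s (≡-sym eq))
    f-inj {suc s} {suc t} eq =
      cong suc (p-inj (Maybe.just-injective
        (trans (≡-sym (g-part s)) (trans (cong part eq) (g-part t)))))
    g-adj : ∀ s t → adj G (g s) (g t) ≡ not (does (s ≟ t))
    g-adj s t with s ≟ t
    ... | yes refl = irrefl G (g s)
    ... | no s≢t   = complete (g s) (g t) (p s) (p t) (g-part s) (g-part t) (s≢t ∘ p-inj)
    f-adj : ∀ x y → adj G (f x) (f y) ≡ cliqueWithApex r x y
    f-adj zero    zero    = irrefl G v
    f-adj zero    (suc t) = proj₂ (proj₂ (wit t))
    f-adj (suc s) zero    = trans (Graph.sym G (g s) v) (proj₂ (proj₂ (wit s)))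
    f-adj (suc s) (suc t) = g-adj s t

  clique-from-neighbours : ∀ {v} → part v ≡ nothing → (∀ k → AdjIn v true k) → HasClique G (suc ω)
  clique-from-neighbours pv nbrs with f , f-inj , f-adj ← apex-copy pv id (λ _ → true) nbrs =
    f , f-inj , λ x y x≢y → trans (f-adj x y) (cliqueWithApex-full x≢y)

  induced-HVN : ∀ {v a b c d} → part v ≡ nothing → Unique (a ∷ b ∷ c ∷ d ∷ []) →
                AdjIn v false a → AdjIn v false b → AdjIn v true c → AdjIn v true d →
                InducedCopy G 5 HVN
  induced-HVN {v} {a} {b} {c} {d} pv distinct wa wb wc wd =
    InducedCopy-resp G HVN≗cliqueWithApex
      (apex-copy pv (lookup-injective distinct _ _) HVN-apexRow wit)
    where
    wit : ∀ t → AdjIn v (HVN-apexRow t) (lookup (a ∷ b ∷ c ∷ d ∷ []) t)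
    wit zero                   = wa
    wit (suc zero)             = wb
    wit (suc (suc zero))       = wc
    wit (suc (suc (suc zero))) = wd

  module _ (v : V) (k : Fin ω) where

    addToPart : V → Maybe (Fin ω)
    addToPart w with w ≟ v
    ... | yes _ = just k
    ... | no _  = part w

    addToPart-self : addToPart v ≡ just k
    addToPart-self with v ≟ v
    ... | yes _  = refl
    ... | no v≢v = ⊥-elim (v≢v refl)

    addToPart-outside : ∀ {w} → w ≢ v → addToPart w ≡ part w
    addToPart-outside {w} w≢v with w ≟ v
    ... | yes w≡v = ⊥-elim (w≢v w≡v)
    ... | no _    = refl

    addToPart-just : ∀ w {i} → addToPart w ≡ just i → (w ≡ v × i ≡ k) ⊎ (w ≢ v × part w ≡ just i)
    addToPart-just w eq with w ≟ v
    ... | yes w≡v = inj₁ (w≡v , ≡-sym (Maybe.just-injective eq))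
    ... | no w≢v  = inj₂ (w≢v , eq)

  order-addToPart : ∀ {v} k → part v ≡ nothing → order G ω part < order G ω (addToPart v k)
  order-addToPart {v} k pv =
    countTrue-mono-< (n G) grows v (cong is-just pv) (cong is-just (addToPart-self v k))
    where
    grows : ∀ w → is-just (part w) ≡ true → is-just (addToPart v k w) ≡ true
    grows w pw with w ≟ v
    ... | yes _ = refl
    ... | no _  = pw

  module _ {v : V} (pv : part v ≡ nothing) {k : Fin ω}
           (anticomplete : ∀ w → part w ≡ just k → adj G v w ≡ false)
           (complete-outside : ∀ w j → part w ≡ just j → j ≢ k → adj G v w ≡ true) where

    addToPart-nonempty : ∀ i → ∃ λ w → addToPart v k w ≡ just i
    addToPart-nonempty i =
      let (w , pw) = nonempty i
          w≢v w≡v = case trans (≡-sym pv) (trans (cong part (≡-sym w≡v)) pw) of λ ()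
      in w , trans (addToPart-outside v k w≢v) pw

    addToPart-stable : ∀ u w i → addToPart v k u ≡ just i → addToPart v k w ≡ just i →
                       adj G u w ≡ false
    addToPart-stable u w i pu pw with addToPart-just v k u pu | addToPart-just v k w pw
    ... | inj₁ (refl , refl) | inj₁ (refl , _)    = irrefl G v
    ... | inj₁ (refl , refl) | inj₂ (_ , pw′)     = anticomplete w pw′
    ... | inj₂ (_ , pu′)     | inj₁ (refl , refl) = trans (Graph.sym G u v) (anticomplete u pu′)
    ... | inj₂ (_ , pu′)     | inj₂ (_ , pw′)     = stable u w i pu′ pw′

    addToPart-complete : ∀ u w i j → addToPart v k u ≡ just i → addToPart v k w ≡ just j → i ≢ j →
                         adj G u w ≡ true
    addToPart-complete u w i j pu pw i≢j with addToPart-just v k u pu | addToPart-just v k w pw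
    ... | inj₁ (refl , refl) | inj₁ (refl , refl) = ⊥-elim (i≢j refl)
    ... | inj₁ (refl , refl) | inj₂ (_ , pw′)     = complete-outside w j pw′ (≢-sym i≢j)
    ... | inj₂ (_ , pu′)     | inj₁ (refl , refl) =
      trans (Graph.sym G u v) (complete-outside u i pu′ i≢j)
    ... | inj₂ (_ , pu′)     | inj₂ (_ , pw′)     = complete u w i j pu′ pw′ i≢j

    addToPart-isCompleteMultipartite : IsCompleteMultipartite G ω (addToPart v k)
    addToPart-isCompleteMultipartite = addToPart-nonempty , addToPart-stable , addToPart-complete

  ¬adjIn-true⇒adjIn-false : ∀ {v k} → ¬ AdjIn v true k → AdjIn v false k
  ¬adjIn-true⇒adjIn-false {v} {k} ¬vk with adjIn-some v k
  ... | true  , vk = ⊥-elim (¬vk vk)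
  ... | false , vk = vk

  ¬adjIn⇒≢ : ∀ {v b k l} → ¬ AdjIn v b k → AdjIn v b l → k ≢ l
  ¬adjIn⇒≢ ¬vk vl refl = ¬vk vl

  induced-HVN-via-fourth-part :
    ∀ {v i j k k′ m} → part v ≡ nothing →
    i ≢ j → k ≢ i → k ≢ j → k′ ≢ k → m ≢ i → m ≢ j → m ≢ k →
    AdjIn v true i → AdjIn v true j → AdjIn v false k → AdjIn v false k′ →
    InducedCopy G 5 HVN
  induced-HVN-via-fourth-part {v} {i} {j} {k} {k′} {m}
                              pv i≢j k≢i k≢j k′≢k m≢i m≢j m≢k vi vj v̄k v̄k′
    with adjIn-some v m | k′ ≟ i | k′ ≟ j
  ... | false , v̄m | _        | _        = induced-HVN pv
        ((≢-sym m≢k ∷ k≢i ∷ k≢j ∷ []) ∷ (m≢i ∷ m≢j ∷ []) ∷ (i≢j ∷ []) ∷ [] ∷ [])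
        v̄k v̄m vi vj
  ... | true  , vm | yes refl | _        = induced-HVN pv
        ((k≢i ∷ k≢j ∷ ≢-sym m≢k ∷ []) ∷ (i≢j ∷ ≢-sym m≢i ∷ []) ∷ (≢-sym m≢j ∷ []) ∷ [] ∷ [])
        v̄k v̄k′ vj vm
  ... | true  , vm | _        | yes refl = induced-HVN pv
        ((k≢j ∷ k≢i ∷ ≢-sym m≢k ∷ []) ∷ (≢-sym i≢j ∷ ≢-sym m≢j ∷ []) ∷ (≢-sym m≢i ∷ []) ∷ [] ∷ [])
        v̄k v̄k′ vi vm
  ... | true  , vm | no k′≢i  | no k′≢j  = induced-HVN pv
        ((≢-sym k′≢k ∷ k≢i ∷ k≢j ∷ []) ∷ (k′≢i ∷ k′≢j ∷ []) ∷ (i≢j ∷ []) ∷ [] ∷ [])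
        v̄k v̄k′ vi vj

  module _ (noLargerClique : ¬ HasClique G (suc ω))
           (maximum : ∀ part′ → IsCompleteMultipartite G ω part′ → order G ω part′ ≤ order G ω part)
           {v : V} (pv : part v ≡ nothing) where

    missed-part : ∃ λ k → ¬ AdjIn v true k
    missed-part = ¬∀⟶∃¬ ω _ (adjIn? v true) (noLargerClique ∘ clique-from-neighbours pv)

    non-neighbour-outside : ∀ {k} → (∀ w → part w ≡ just k → adj G v w ≡ false) →
                          ∃ λ k′ → k′ ≢ k × AdjIn v false k′
    non-neighbour-outside {k} anticomplete =
      decidable-stable (any? λ k′ → ¬? (k′ ≟ k) ×-dec adjIn? v false k′) λ none →
        <⇒≱ (order-addToPart k pv)
            (maximum _ (addToPart-isCompleteMultipartite pv anticomplete
                         λ w j pw j≢k → ¬-not λ vw → none (j , j≢k , w , pw , vw)))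

    neighbours-in-two-parts⇒HVN : 4 ≤ ω → ∀ {i j} → i ≢ j → AdjIn v true i → AdjIn v true j →
                                   InducedCopy G 5 HVN
    neighbours-in-two-parts⇒HVN 4≤ω {i} {j} i≢j vi vj
      with k , ¬vk ← missed-part
      with k′ , k′≢k , v̄k′ ← non-neighbour-outside (¬adjIn-true ¬vk)
      with m , m∉ ← ∃-∉ (i ∷ j ∷ k ∷ []) 4≤ω =
      induced-HVN-via-fourth-part pv i≢j (¬adjIn⇒≢ ¬vk vi) (¬adjIn⇒≢ ¬vk vj) k′≢k
        (m∉ ∘ here) (m∉ ∘ there ∘ here) (m∉ ∘ there ∘ there ∘ here)
        vi vj (¬adjIn-true⇒adjIn-false ¬vk) v̄k′

lemma3p1 : (G : Graph) → Free G 6 P2∪P4 → Free G 5 HVN →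
    (ω : ℕ) → IsCliqueNumber G ω → 4 ≤ ω →
    (part : Fin (n G) → Maybe (Fin ω)) → IsMaxCompleteMultipartite G ω part →
    ∀ v → part v ≡ nothing →
    ∀ u₁ u₂ i j → adj G v u₁ ≡ true → adj G v u₂ ≡ true →
    part u₁ ≡ just i → part u₂ ≡ just j → i ≡ j
lemma3p1 G _ HVN-free ω (_ , noLargerClique) 4≤ω part (multipartite , maximum)
         v pv u₁ u₂ i j vu₁ vu₂ pu₁ pu₂ =
  decidable-stable (i ≟ j) λ i≢j →
    HVN-free (neighbours-in-two-parts⇒HVN G multipartite noLargerClique maximum pv 4≤ω i≢j
                (u₁ , pu₁ , vu₁) (u₂ , pu₂ , vu₂))
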